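{- Let $n,d>1$ be integers and let $p$ be an odd prime such that $r(\mathrm{GL}(nd)_\mathbb{Q}, p) > 0$. Then \[ r(\mathrm{GL}(dn)_\mathbb{Q}, p) > r(\mathrm{GL}(n)_\mathbb{Q}, p) + r(S_d, p). \]
   Context: For a (smooth linear) group scheme $G$ of finite type over $\mathbb{Q}$, choose a model over $\mathbb{Z}[1/N]$ for some positive integer $N$, so that $G(\mathbb{F}_q)$ makes sense for all but finitely many primes $q$. The nonnegative integers $r(G,p)$ are defined by $\prod_p p^{r(G,p)} = \sup_S \{\gcd_{q \in S} \#G(\mathbb{F}_q)\}$, where $S$ runs over all cofinite sets of primes. The symmetric group $S_d$ is regarded as a constant finite group scheme, so $r(S_d,p)$ is the $p$-adic valuation of $d!$. Explicitly, for $p$ odd, $r(\mathrm{GL}(n)_\mathbb{Q},p) = \sum_{i \geq 0} \lfloor n/((p-1)p^i) \rfloor$. -}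

module Defs where

open import Data.Nat using (ℕ; zero; suc; _+_; _*_; _∸_; _^_)
open import Data.Nat.DivMod using (_/_)
open import Data.Nat.Divisibility using (_∣_)
open import Data.Product using (_×_)
open import Relation.Nullary using (¬_)

-- total floor division: m div 0 = 0 (never used with divisor 0 below)
_div_ : ℕ → ℕ → ℕ
m div zero = 0
m div suc k = m / suc k

sumBelow : ℕ → (ℕ → ℕ) → ℕ
sumBelow zero f = 0
sumBelow (suc b) f = sumBelow b f + f b

-- r(GL(n)_Q, p) for p odd:  Σ_{i ≥ 0} ⌊ n / ((p-1) p^i) ⌋.
-- For p ≥ 2 and i ≥ n we have (p-1) p^i ≥ 2^i > n, so all terms with
-- i ≥ n vanish; the sum is therefore taken over i < n + 1 (exact).
rGL : ℕ → ℕ → ℕ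
rGL n p = sumBelow (suc n) (λ i → n div ((p ∸ 1) * p ^ i))

IsValuation : ℕ → ℕ → ℕ → Set
IsValuation p m k = (p ^ k ∣ m) × ¬ (p ^ suc k ∣ m)

{-# OPTIONS --safe #-}
module Submission where

-- With q = p − 1, Legendre's formula bounds v_p(d!) by Σ_{i≥0} ⌊d/p^{i+1}⌋. Since q p^i ≤ p^{i+1}
-- and d ≤ (d − 1) n, each such term is at most ⌊(d − 1) n/(q p^i)⌋, and ⌊n/x⌋ + ⌊(d − 1) n/x⌋ ≤ ⌊dn/x⌋,
-- so r(GL(n), p) + r(S_d, p) ≤ r(GL(dn), p) term by term. The term i = 0 is strict once q ≤ dn,
-- which is what r(GL(nd), p) > 0 means.

open import Defs
open import Data.Nat using (ℕ; _+_; _*_; _<_; _%_; _!)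
open import Data.Nat.Primality using (Prime)
open import Relation.Binary.PropositionalEquality using (_≡_)

open import Data.Nat.Base
  using (zero; suc; _^_; _∸_; _≤_; _≤′_; ≤′-refl; ≤′-step; z≤n; s≤s; z<s; NonZero; NonTrivial; >-nonZero; nonTrivial⇒n>1; nonTrivial⇒≢1)
open import Data.Nat.Properties
open import Data.Nat.DivMod using (_/_; m/n*n≤m; m*n/n≡m; m/n*n≡m; /-monoˡ-≤; /-monoʳ-≤; m<n⇒m/n≡0; m≥n⇒m/n>0)
open import Data.Nat.Divisibility using (_∣_; divides; ∣-trans; ∣⇒≤; ∣1⇒≡1; 1∣_; m∣m*n; *-monoʳ-∣; *-cancelˡ-∣)
open import Data.Nat.Primality using (euclidsLemma; prime⇒nonZero; prime⇒nonTrivial)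
open import Algebra.Properties.CommutativeSemigroup +-commutativeSemigroup as +-CS using ()
open import Algebra.Properties.CommutativeSemigroup *-commutativeSemigroup as *-CS using ()
open import Data.Product using (∃₂; _×_; _,_)
open import Data.Sum using (inj₁; inj₂)
open import Function using (_∘_)
open import Relation.Nullary using (yes; no)
open import Relation.Nullary.Negation using (contradiction)
open import Relation.Binary.PropositionalEquality using (refl; sym; trans; cong; cong₂; subst)

m*n≤o⇒m≤o/n : ∀ m o n .{{_ : NonZero n}} → m * n ≤ o → m ≤ o / n
m*n≤o⇒m≤o/n m o n mn≤o = subst (_≤ o / n) (m*n/n≡m m n) (/-monoˡ-≤ n mn≤o)

m/n+o/n≤[m+o]/n : ∀ m o n .{{_ : NonZero n}} → m / n + o / n ≤ (m + o) / n
m/n+o/n≤[m+o]/n m o n = m*n≤o⇒m≤o/n (m / n + o / n) (m + o) n (begin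
  (m / n + o / n) * n     ≡⟨ *-distribʳ-+ n (m / n) (o / n) ⟩
  m / n * n + o / n * n   ≤⟨ +-mono-≤ (m/n*n≤m m n) (m/n*n≤m o n) ⟩
  m + o                   ∎)
  where open ≤-Reasoning

n∣1+m⇒m/n<[1+m]/n : ∀ m n .{{_ : NonZero n}} → n ∣ suc m → m / n < suc m / n
n∣1+m⇒m/n<[1+m]/n m n n∣1+m = *-cancelʳ-< n (m / n) (suc m / n) (begin-strict
  m / n * n       ≤⟨ m/n*n≤m m n ⟩
  m               <⟨ n<1+n m ⟩
  suc m           ≡⟨ sym (m/n*n≡m n∣1+m) ⟩
  suc m / n * n   ∎)
  where open ≤-Reasoning

div≡/ : ∀ m n .{{_ : NonZero n}} → m div n ≡ m / n
div≡/ m (suc n) = refl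

n<m^n : ∀ {m} → 1 < m → ∀ n → n < m ^ n
n<m^n 1<m zero          = s≤s z≤n
n<m^n {m} 1<m (suc n)   = ≤-<-trans (n<m^n 1<m n) (^-monoʳ-< m 1<m (n<1+n n))

^-monoʳ-∣ : ∀ m {i j} → i ≤ j → m ^ i ∣ m ^ j
^-monoʳ-∣ m {i} {j} i≤j = divides (m ^ (j ∸ i)) (begin-equality
  m ^ j                 ≡⟨ cong (m ^_) (sym (m+[n∸m]≡n i≤j)) ⟩
  m ^ (i + (j ∸ i))     ≡⟨ ^-distribˡ-+-* m i (j ∸ i) ⟩
  m ^ i * m ^ (j ∸ i)   ≡⟨ *-comm (m ^ i) (m ^ (j ∸ i)) ⟩
  m ^ (j ∸ i) * m ^ i   ∎)
  where open ≤-Reasoning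

m+m≤m*n : ∀ m {n} → 2 ≤ n → m + m ≤ m * n
m+m≤m*n m {n} 2≤n = begin
  m + m        ≡⟨ cong (m +_) (sym (+-identityʳ m)) ⟩
  2 * m        ≤⟨ *-monoˡ-≤ m 2≤n ⟩
  n * m        ≡⟨ *-comm n m ⟩
  m * n        ∎
  where open ≤-Reasoning

1+m≤m*n : ∀ {m n} → 1 ≤ m → 2 ≤ n → suc m ≤ m * n
1+m≤m*n {m} 1≤m 2≤n = ≤-trans (+-monoˡ-≤ m 1≤m) (m+m≤m*n m 2≤n)

sumBelow-cong : ∀ B {f g} → (∀ i → f i ≡ g i) → sumBelow B f ≡ sumBelow B g
sumBelow-cong zero    f≡g = refl
sumBelow-cong (suc B) f≡g = cong₂ _+_ (sumBelow-cong B f≡g) (f≡g B)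

sumBelow-zero : ∀ B {f} → (∀ i → f i ≡ 0) → sumBelow B f ≡ 0
sumBelow-zero zero    f≡0 = refl
sumBelow-zero (suc B) f≡0 = cong₂ _+_ (sumBelow-zero B f≡0) (f≡0 B)

sumBelow-monoˡ-≤ : ∀ f {B C} → B ≤ C → sumBelow B f ≤ sumBelow C f
sumBelow-monoˡ-≤ f B≤C = go (≤⇒≤′ B≤C)
  where
  go : ∀ {B C} → B ≤′ C → sumBelow B f ≤ sumBelow C f
  go ≤′-refl          = ≤-refl
  go (≤′-step B≤′C)   = ≤-trans (go B≤′C) (m≤m+n _ _)

sumBelow-+-< : ∀ B {f g h} → (∀ i → f i + g i ≤ h i) → f 0 + g 0 < h 0 →
               sumBelow (suc B) f + sumBelow (suc B) g < sumBelow (suc B) h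
sumBelow-+-< zero    fg≤h fg<h = fg<h
sumBelow-+-< (suc B) {f} {g} fg≤h fg<h = <-≤-trans
  (≤-reflexive (cong suc (+-CS.interchange (sumBelow (suc B) f) (f (suc B)) (sumBelow (suc B) g) (g (suc B)))))
  (+-mono-<-≤ (sumBelow-+-< B fg≤h fg<h) (fg≤h (suc B)))

sumBelow-+-prefix : ∀ B {e f g} → e ≤ B → (∀ i → f i ≤ g i) → (∀ i → i < e → f i < g i) →
                    sumBelow B f + e ≤ sumBelow B g
sumBelow-+-prefix zero    z≤n f≤g f<g = z≤n
sumBelow-+-prefix (suc B) {e} {f} {g} e≤1+B f≤g f<g with m≤n⇒m<n∨m≡n e≤1+B
... | inj₁ (s≤s e≤B) = begin
  sumBelow B f + f B + e          ≡⟨ +-CS.xy∙z≈xz∙y (sumBelow B f) (f B) e ⟩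
  sumBelow B f + e + f B          ≤⟨ +-mono-≤ (sumBelow-+-prefix B e≤B f≤g f<g) (f≤g B) ⟩
  sumBelow B g + g B              ∎
  where open ≤-Reasoning
... | inj₂ refl = begin
  sumBelow B f + f B + suc B      ≡⟨ +-suc (sumBelow B f + f B) B ⟩
  suc (sumBelow B f + f B + B)    ≡⟨ cong suc (+-CS.xy∙z≈xz∙y (sumBelow B f) (f B) B) ⟩
  suc (sumBelow B f + B + f B)    ≡⟨ sym (+-suc (sumBelow B f + B) (f B)) ⟩
  sumBelow B f + B + suc (f B)    ≤⟨ +-mono-≤ (sumBelow-+-prefix B ≤-refl f≤g f<g′) (f<g B ≤-refl) ⟩
  sumBelow B g + g B              ∎
  where
  open ≤-Reasoning
  f<g′ : ∀ i → i < B → f i < g i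
  f<g′ i i<B = f<g i (m<n⇒m<1+n i<B)

legendreSum : (p : ℕ) .{{_ : NonZero p}} → ℕ → ℕ → ℕ
legendreSum p B m = sumBelow B (λ i → (m / p ^ suc i) {{m^n≢0 p (suc i)}})

module _ {p} (prime-p : Prime p) where
  private instance
    p≢0 : NonZero p
    p≢0 = prime⇒nonZero prime-p
    p≢1 : NonTrivial p
    p≢1 = prime⇒nonTrivial prime-p

  private
    cancel-p : ∀ r a b → p ^ suc r ∣ a * p * b → p ^ r ∣ a * b
    cancel-p r a b = *-cancelˡ-∣ p ∘ subst (p ^ suc r ∣_) (*-CS.xy∙z≈y∙xz a p b)

    extend-p : ∀ e {a} → p ^ e ∣ a → p ^ suc e ∣ a * p
    extend-p e {a} p^e∣a = subst (p ^ suc e ∣_) (*-comm p a) (*-monoʳ-∣ p p^e∣a)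

  prime^∣*-split : ∀ r a b → p ^ r ∣ a * b → ∃₂ λ e s → p ^ e ∣ a × p ^ s ∣ b × r ≤ e + s
  prime^∣*-split zero a b _ = 0 , 0 , 1∣ a , 1∣ b , z≤n
  prime^∣*-split (suc r) a b p^r∣ab with euclidsLemma a b prime-p (∣-trans (m∣m*n (p ^ r)) p^r∣ab)
  ... | inj₁ (divides a′ refl) =
    let e , s , p^e∣a′ , p^s∣b , r≤e+s = prime^∣*-split r a′ b (cancel-p r a′ b p^r∣ab)
    in suc e , s , extend-p e p^e∣a′ , p^s∣b , s≤s r≤e+s
  ... | inj₂ (divides b′ refl) =
    let p^r∣b′a = cancel-p r b′ a (subst (p ^ suc r ∣_) (*-comm a (b′ * p)) p^r∣ab)
        e , s , p^e∣b′ , p^s∣a , r≤e+s = prime^∣*-split r b′ a p^r∣b′a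
    in s , suc e , p^s∣a , extend-p e p^e∣b′ ,
       subst (suc r ≤_) (sym (+-suc s e)) (s≤s (subst (r ≤_) (+-comm e s) r≤e+s))

  legendreSum-step : ∀ B m {e} → e ≤ B → p ^ e ∣ suc m → legendreSum p B m + e ≤ legendreSum p B (suc m)
  legendreSum-step B m e≤B p^e∣1+m = sumBelow-+-prefix B e≤B
    (λ i → /-monoˡ-≤ (p ^ suc i) {{m^n≢0 p (suc i)}} (n≤1+n m))
    (λ i i<e → n∣1+m⇒m/n<[1+m]/n m (p ^ suc i) {{m^n≢0 p (suc i)}} (∣-trans (^-monoʳ-∣ p i<e) p^e∣1+m))

  legendre-bound : ∀ B m {r} → m ≤ B → p ^ r ∣ m ! → r ≤ legendreSum p B m
  legendre-bound B zero {r} _ p^r∣1 with m^n≡1⇒n≡0∨m≡1 p r (∣1⇒≡1 p^r∣1)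
  ... | inj₁ refl = z≤n
  ... | inj₂ p≡1  = contradiction p≡1 (nonTrivial⇒≢1)
  legendre-bound B (suc m) {r} 1+m≤B p^r∣[1+m]! =
    let e , s , p^e∣1+m , p^s∣m! , r≤e+s = prime^∣*-split r (suc m) (m !) p^r∣[1+m]!
        e≤m : e ≤ m
        e≤m = ≤-pred (<-≤-trans (n<m^n (nonTrivial⇒n>1 p) e) (∣⇒≤ p^e∣1+m))
    in begin
      r                                 ≤⟨ r≤e+s ⟩
      e + s                             ≤⟨ +-monoʳ-≤ e (legendre-bound B m (<⇒≤ 1+m≤B) p^s∣m!) ⟩
      e + legendreSum p B m             ≡⟨ +-comm e _ ⟩
      legendreSum p B m + e             ≤⟨ legendreSum-step B m (≤-trans e≤m (<⇒≤ 1+m≤B)) p^e∣1+m ⟩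
      legendreSum p B (suc m)           ∎
    where open ≤-Reasoning

n/x+d/y≤[d*n]/x : ∀ {x y} .{{_ : NonZero x}} .{{_ : NonZero y}} → x ≤ y →
                  ∀ n d → 1 < n → 1 < d → n / x + d / y ≤ (d * n) / x
n/x+d/y≤[d*n]/x {x} {y} x≤y n (suc d₁) 1<n (s≤s 1≤d₁) = begin
  n / x + suc d₁ / y   ≤⟨ +-monoʳ-≤ (n / x) (/-monoʳ-≤ (suc d₁) x≤y) ⟩
  n / x + suc d₁ / x   ≤⟨ +-monoʳ-≤ (n / x) (/-monoˡ-≤ x (1+m≤m*n 1≤d₁ 1<n)) ⟩
  n / x + d₁ * n / x   ≤⟨ m/n+o/n≤[m+o]/n n (d₁ * n) x ⟩
  (n + d₁ * n) / x     ∎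
  where open ≤-Reasoning

[2+k]*q≤m*n : ∀ k {q p m n} → q < p → 2 ≤ n → suc k * p ≤ suc m → suc (suc k) * q ≤ m * n
[2+k]*q≤m*n k {q} {p} {m} q<p 2≤n [1+k]p≤1+m = ≤-trans (+-mono-≤ q≤m [1+k]q≤m) (m+m≤m*n m 2≤n)
  where
  q≤m : q ≤ m
  q≤m = ≤-pred (<-≤-trans q<p (≤-trans (m≤n*m p (suc k)) [1+k]p≤1+m))
  [1+k]q≤m : suc k * q ≤ m
  [1+k]q≤m = ≤-pred (<-≤-trans (*-monoʳ-< (suc k) q<p) [1+k]p≤1+m)

-- With k = ⌊d/p⌋ it suffices that (k + 1) q ≤ (d − 1) n; this holds when k ≥ 1, and
-- when it fails for k = 0 we have n < q, so ⌊n/q⌋ = 0 while ⌊dn/q⌋ ≥ 1.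
n/q+d/p<[d*n]/q : ∀ {q p} .{{_ : NonZero q}} .{{_ : NonZero p}} → q < p →
                  ∀ n d → 1 < n → 1 < d → q ≤ d * n → n / q + d / p < (d * n) / q
n/q+d/p<[d*n]/q {q} {p} q<p n (suc d₁) 1<n (s≤s 1≤d₁) q≤dn = bound (suc d₁ / p) (m/n*n≤m (suc d₁) p)
  where
  open ≤-Reasoning
  below : ∀ {k} → suc k * q ≤ d₁ * n → n / q + k < (suc d₁ * n) / q
  below {k} [1+k]q≤d₁n = begin-strict
    n / q + k            <⟨ +-monoʳ-< (n / q) (n<1+n k) ⟩
    n / q + suc k        ≤⟨ +-monoʳ-≤ (n / q) (m*n≤o⇒m≤o/n (suc k) (d₁ * n) q [1+k]q≤d₁n) ⟩
    n / q + d₁ * n / q   ≤⟨ m/n+o/n≤[m+o]/n n (d₁ * n) q ⟩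
    (n + d₁ * n) / q     ∎
  bound : ∀ k → k * p ≤ suc d₁ → n / q + k < (suc d₁ * n) / q
  bound (suc k) kp≤d = below ([2+k]*q≤m*n k q<p 1<n kp≤d)
  bound zero _ with q ≤? d₁ * n
  ... | yes q≤d₁n = below (subst (_≤ d₁ * n) (sym (+-identityʳ q)) q≤d₁n)
  ... | no  q≰d₁n = subst (_< (suc d₁ * n) / q) (sym (trans (+-identityʳ (n / q)) n/q≡0)) (m≥n⇒m/n>0 q≤dn)
    where
    n/q≡0 : n / q ≡ 0
    n/q≡0 = m<n⇒m/n≡0 (≤-<-trans (m≤n*m n d₁ {{>-nonZero 1≤d₁}}) (≰⇒> q≰d₁n))

module _ {p} (1<p : 1 < p) where
  private instance
    p≢0 : NonZero p
    p≢0 = >-nonZero (<-trans z<s 1<p)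
    p∸1≢0 : NonZero (p ∸ 1)
    p∸1≢0 = >-nonZero (m<n⇒0<n∸m 1<p)

  glDenom≢0 : ∀ i → NonZero ((p ∸ 1) * p ^ i)
  glDenom≢0 i = m*n≢0 (p ∸ 1) (p ^ i) {{p∸1≢0}} {{m^n≢0 p i}}

  glTerm : ℕ → ℕ → ℕ
  glTerm m i = (m / ((p ∸ 1) * p ^ i)) {{glDenom≢0 i}}

  rGL≡sumBelow-glTerm : ∀ m → rGL m p ≡ sumBelow (suc m) (glTerm m)
  rGL≡sumBelow-glTerm m = sumBelow-cong (suc m) (λ i → div≡/ m ((p ∸ 1) * p ^ i) {{glDenom≢0 i}})

  rGL>0⇒p∸1≤m : ∀ m → 0 < rGL m p → p ∸ 1 ≤ m
  rGL>0⇒p∸1≤m m rGL>0 with p ∸ 1 ≤? m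
  ... | yes p∸1≤m = p∸1≤m
  ... | no  p∸1≰m = contradiction (trans (rGL≡sumBelow-glTerm m) (sumBelow-zero (suc m) glTerm≡0)) (>⇒≢ rGL>0)
    where
    glTerm≡0 : ∀ i → glTerm m i ≡ 0
    glTerm≡0 i = m<n⇒m/n≡0 {{glDenom≢0 i}} (<-≤-trans (≰⇒> p∸1≰m) (m≤m*n (p ∸ 1) (p ^ i) {{m^n≢0 p i}}))

  rGL+legendreSum<rGL : ∀ n d → 1 < n → 1 < d → p ∸ 1 ≤ d * n → rGL n p + legendreSum p d d < rGL (d * n) p
  rGL+legendreSum<rGL n d 1<n 1<d p∸1≤dn = begin-strict
    rGL n p + legendreSum p d d
      ≡⟨ cong (_+ legendreSum p d d) (rGL≡sumBelow-glTerm n) ⟩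
    sumBelow (suc n) (glTerm n) + legendreSum p d d
      ≤⟨ +-mono-≤ (sumBelow-monoˡ-≤ (glTerm n) (s≤s n≤dn)) (sumBelow-monoˡ-≤ _ (m≤n⇒m≤1+n d≤dn)) ⟩
    sumBelow (suc (d * n)) (glTerm n) + legendreSum p (suc (d * n)) d
      <⟨ sumBelow-+-< (d * n) termwise first-term ⟩
    sumBelow (suc (d * n)) (glTerm (d * n))
      ≡⟨ sym (rGL≡sumBelow-glTerm (d * n)) ⟩
    rGL (d * n) p ∎
    where
    open ≤-Reasoning
    n≤dn : n ≤ d * n
    n≤dn = m≤n*m n d {{>-nonZero (<-trans z<s 1<d)}}
    d≤dn : d ≤ d * n
    d≤dn = m≤m*n d n {{>-nonZero (<-trans z<s 1<n)}}
    termwise : ∀ i → glTerm n i + (d / p ^ suc i) {{m^n≢0 p (suc i)}} ≤ glTerm (d * n) i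
    termwise i = n/x+d/y≤[d*n]/x {{glDenom≢0 i}} {{m^n≢0 p (suc i)}} (*-monoˡ-≤ (p ^ i) (m∸n≤m p 1)) n d 1<n 1<d
    first-term : glTerm n 0 + (d / p ^ 1) {{m^n≢0 p 1}} < glTerm (d * n) 0
    first-term = n/q+d/p<[d*n]/q {{glDenom≢0 0}} {{m^n≢0 p 1}} (*-monoˡ-< 1 (∸-monoʳ-< z<s (<⇒≤ 1<p))) n d 1<n 1<d
               (≤-trans (≤-reflexive (*-identityʳ (p ∸ 1))) p∸1≤dn)

corollary4p4 : (n d p rS : ℕ) → 1 < n → 1 < d → Prime p → p % 2 ≡ 1
    → 0 < rGL (n * d) p → IsValuation p (d !) rS
    → rGL n p + rS < rGL (d * n) p
corollary4p4 n d p rS 1<n 1<d prime-p _ rGL[nd]>0 (p^rS∣d! , _) = begin-strict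
  rGL n p + rS                  ≤⟨ +-monoʳ-≤ (rGL n p) (legendre-bound prime-p d d ≤-refl p^rS∣d!) ⟩
  rGL n p + legendreSum p d d   <⟨ rGL+legendreSum<rGL 1<p n d 1<n 1<d p∸1≤dn ⟩
  rGL (d * n) p                 ∎
  where
  open ≤-Reasoning
  instance _ = prime⇒nonZero prime-p
  1<p : 1 < p
  1<p = nonTrivial⇒n>1 p {{prime⇒nonTrivial prime-p}}
  p∸1≤dn : p ∸ 1 ≤ d * n
  p∸1≤dn = subst (p ∸ 1 ≤_) (*-comm n d) (rGL>0⇒p∸1≤m 1<p (n * d) rGL[nd]>0)
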